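{- Let $H$ be a finite abelian group with a fixed enumeration $H = \{h_0 = 0_H, h_1, \dots, h_{t-1}\}$, let $\bm{\lambda} = (\lambda_0,\dots,\lambda_{t-1})$ be a sequence of nonnegative integers, and let $k = \lambda_0+\lambda_1+\dots+\lambda_{t-1}$. Suppose that for infinitely many primes $p$, every non-zero sum subset of $(\mathbb{Z}_p \times H) \setminus \{0_{\mathbb{Z}_p\times H}\}$ of type $\bm{\lambda}$ is sequenceable. Then for every positive integer $m$ all of whose prime factors are greater than $k!/2$, every non-zero sum subset of $(\mathbb{Z}_m\times H)\setminus\{0_{\mathbb{Z}_m\times H}\}$ of type $\bm{\lambda}$ is sequenceable.
   Context: Let $A$ be an abelian group and $S \subseteq A\setminus\{0\}$ a finite subset of size $k$. For an ordering $(x_1,\dots,x_k)$ of $S$, its partial sums are $y_0 = 0$ and $y_i = x_1+\dots+x_i$. $S$ is sequenceable if some ordering has partial sums $y_0,\dots,y_k$ pairwise distinct, except that $y_k = y_0 = 0$ is permitted. $S$ is non-zero sum if $\sum_{s\in S} s \neq 0$. For a group of the form $X \times H$ with $H$ enumerated as $\{h_0=0_H,h_1,\dots,h_{t-1}\}$, the type of a finite subset $S$ is $\bm{\lambda}=(\lambda_0,\dots,\lambda_{t-1})$ where $\lambda_i$ is the number of elements $s\in S$ whose projection to $H$ equals $h_i$. -}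

module Defs where

open import Level using (Level; _⊔_)
open import Data.Nat using (ℕ; zero; suc; _<_; NonZero; _*_)
open import Data.Nat.DivMod using (_mod_)
open import Data.Nat.Primality using (Prime; prime⇒nonZero)
open import Data.Nat.Divisibility using (_∣_)
open import Data.Nat.Base using (_!)
open import Data.Fin using (Fin; zero; suc; toℕ; fromℕ) renaming (_<_ to _<ᶠ_)
open import Data.Fin.Permutation using (Permutation′; _⟨$⟩ʳ_)
open import Data.List using (List; length; filter; tabulate)
open import Data.Nat.ListAction using (sum)
open import Data.Fin.Properties using (_≟_)
open import Data.Product using (Σ; _×_; _,_; proj₁; proj₂; ∃)
open import Relation.Nullary using (¬_)
open import Relation.Binary.PropositionalEquality using (_≡_)
open import Algebra.Bundles using (AbelianGroup)
open import Function using (_∘_)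

module _ (m : ℕ) .{{_ : NonZero m}} where
  0ℤ : Fin m
  0ℤ = 0 mod m

  _+ℤ_ : Fin m → Fin m → Fin m
  a +ℤ b = (toℕ a Data.Nat.+ toℕ b) mod m

-- A fixed enumeration H = {h_0 = 0_H, h_1, ..., h_{t-1}} of a (hence finite)
-- abelian group H, up to the group's equality _≈_.
record Enumeration {c ℓ : Level} (H : AbelianGroup c ℓ) (t : ℕ) : Set (c ⊔ ℓ) where
  open AbelianGroup H
  field
    elem      : Fin t → Carrier
    elem-zero : Σ (0 < t) λ _ → ∀ (i : Fin t) → toℕ i ≡ 0 → elem i ≈ ε
    injective : ∀ (i j : Fin t) → elem i ≈ elem j → i ≡ j
    surjective : ∀ (x : Carrier) → ∃ λ (i : Fin t) → elem i ≈ x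

count : ∀ {k t} → (Fin k → Fin t) → Fin t → ℕ
count {k} f i = length (filter (λ j → f j ≟ i) (Data.List.allFin k))

total : ∀ {t} → (Fin t → ℕ) → ℕ
total {t} lam = sum (tabulate {n = t} lam)

module Setup {c ℓ : Level} (H : AbelianGroup c ℓ) (m : ℕ) .{{_ : NonZero m}} where
  open AbelianGroup H renaming (Carrier to Hc; _≈_ to _≈H_; _∙_ to _∙H_; ε to εH)

  Elem : Set c
  Elem = Fin m × Hc

  _≈_ : Elem → Elem → Set ℓ
  (a , g) ≈ (b , g') = Σ (a ≡ b) λ _ → g ≈H g'

  _⊕_ : Elem → Elem → Elem
  (a , g) ⊕ (b , g') = (_+ℤ_ m a b , g ∙H g')

  𝟘 : Elem
  𝟘 = (0ℤ m , εH)

  partial : ∀ {k} → (Fin k → Elem) → Fin (suc k) → Elem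
  partial x zero = 𝟘
  partial {suc k} x (suc i) = x zero ⊕ partial (x ∘ suc) i

  sumAll : ∀ {k} → (Fin k → Elem) → Elem
  sumAll {k} x = partial x (fromℕ k)

  -- A k-subset S of (Z_m × H) \ {0}, given as an injective listing S : Fin k → Elem
  IsSubsetNoZero : ∀ {k} → (Fin k → Elem) → Set ℓ
  IsSubsetNoZero {k} S =
    (∀ (i j : Fin k) → S i ≈ S j → i ≡ j) × (∀ (i : Fin k) → ¬ (S i ≈ 𝟘))

  NonZeroSum : ∀ {k} → (Fin k → Elem) → Set ℓ
  NonZeroSum S = ¬ (sumAll S ≈ 𝟘)

  -- S has type λ w.r.t. the enumeration: λ_i = #{s ∈ S : proj_H s = h_i}
  HasType : ∀ {k t} → Enumeration H t → (Fin t → ℕ) → (Fin k → Elem) → Set ℓ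
  HasType {k} {t} E lam S =
    Σ (Fin k → Fin t) λ τ →
      (∀ (j : Fin k) → proj₂ (S j) ≈H Enumeration.elem E (τ j)) ×
      (∀ (i : Fin t) → count τ i ≡ lam i)

  Sequenceable : ∀ {k} → (Fin k → Elem) → Set ℓ
  Sequenceable {k} S =
    Σ (Permutation′ k) λ σ →
      ∀ (i j : Fin (suc k)) → i <ᶠ j →
        partial (λ r → S (σ ⟨$⟩ʳ r)) i ≈ partial (λ r → S (σ ⟨$⟩ʳ r)) j →
        (toℕ i ≡ 0) × (toℕ j ≡ k)

AllSequenceable : ∀ {c ℓ t} (H : AbelianGroup c ℓ) → Enumeration H t → (Fin t → ℕ)
                  → (m : ℕ) → .{{_ : NonZero m}} → Set (c ⊔ ℓ)
AllSequenceable H E lam m = ∀ (S : Fin (total lam) → Elem) →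
    IsSubsetNoZero S → NonZeroSum S → HasType E lam S → Sequenceable S
  where open Setup H m

InfinitelyManyPrimes : ∀ {c ℓ t} (H : AbelianGroup c ℓ) → Enumeration H t → (Fin t → ℕ) → Set (c ⊔ ℓ)
InfinitelyManyPrimes H E lam =
  ∀ (N : ℕ) → Σ ℕ λ p → Σ (Prime p) λ pp →
    (N < p) × AllSequenceable H E lam p {{prime⇒nonZero pp}}

-- Write u for the integer representatives of the ℤ_m-coordinates of S, and call a 0/1 vector v
-- a relation when v · u ≡ 0 (mod m); two equal partial sums of an ordering of S give one.
-- The relations form a 0/1 matrix, so a square minor of size s ≤ k is at most ⌈s!/2⌉ in absolute
-- value, which is smaller than every prime factor of m: every minor is zero or a unit modulo m.
-- Fraction-free elimination (Chio condensation) then yields an integer vector z with v · z = 0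
-- for every relation and z ≡ d u (mod m) for a unit d. For a prime p > 2 ‖z‖₁, replacing u by
-- z mod p gives a subset S′ of ℤ_p × H of the same type, still injective, avoiding 0 and with
-- non-zero sum, because a combination of z that is small and ≡ 0 (mod p) is 0, and then the same
-- combination of u is ≡ 0 (mod m). A sequencing of S′ sequences S: a repeated partial sum of S
-- is a relation, so the corresponding partial sums of S′ coincide as integers.

module Submission where

open import Defs using (Enumeration; InfinitelyManyPrimes; AllSequenceable; total; module Setup)
  renaming (0ℤ to 0ₘ; _+ℤ_ to _+ₘ_)
open import Level using (Level; 0ℓ)
open import Algebra.Bundles using (AbelianGroup)
open import Data.Nat
  using (ℕ; zero; suc; s≤s; z≤n; _≤_; _<_; _<?_; _∸_; _!; NonZero; ≢-nonZero; ≢-nonZero⁻¹; nonTrivial⇒n>1)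
  renaming (_+_ to _+ℕ_; _*_ to _*ℕ_)
import Data.Nat.Properties as ℕ
import Data.Nat.Divisibility as ℕ
open import Data.Nat.Divisibility using () renaming (_∣_ to _∣ℕ_)
open import Data.Nat.DivMod using (_mod_; m%n<n)
open import Data.Nat.Combinatorics using (k![n∸k]!∣n!)
open import Data.Nat.Coprimality using (Coprime; coprime-divisor)
open import Data.Nat.Primality using (Prime; prime⇒nonZero; prime⇒nonTrivial)
open import Data.Nat.Primality.Factorisation using (factorise)
open import Data.Integer using (ℤ; +_; +0; +[1+_]; -[1+_]; ∣_∣; -_; _+_; _-_; _*_; _^_; 0ℤ; 1ℤ; _%ℕ_; _/ℕ_)
import Data.Integer.Properties as ℤ
open import Data.Integer.DivMod using (n%ℕd<d; a≡a%ℕn+[a/ℕn]*n)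
open import Data.Integer.Divisibility.Signed
  using (_∣_; _∣?_; divides; ∣m∣n⇒∣m+n; ∣m⇒∣-m; ∣n⇒∣m*n; ∣⇒∣ᵤ; ∣ᵤ⇒∣)
open import Data.Integer.Tactic.RingSolver using (solve-∀)
open import Algebra.Properties.Semiring.Sum ℤ.+-*-semiring
  using (sum; sum-cong-≗; sum-replicate-zero; sum-remove; ∑-distrib-+; *-distribˡ-sum; ∑-permute)
open import Data.Fin using (Fin; zero; suc; toℕ; inject₁; fromℕ; fromℕ<; punchIn; punchOut; _≟_)
  renaming (_≤_ to _≤ᶠ_; _<_ to _<ᶠ_)
open import Data.Fin.Patterns using (0F; 1F)
import Data.Fin.Properties as Fin
open import Data.Fin.Permutation using (Permutation′; transpose; _⟨$⟩ʳ_; _⟨$⟩ˡ_; inverseˡ)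
open import Data.Fin.Subset using (Subset)
open import Data.Fin.Subset.Properties using (anySubset?)
open import Data.Vec using (tabulate; lookup)
open import Data.Vec.Properties using (lookup∘tabulate)
open import Data.Vec.Functional using (_∷_; tail; updateAt)
open import Data.Vec.Functional.Properties using (updateAt-updates; updateAt-minimal)
import Data.List as List
import Data.List.Relation.Unary.All as All
open import Data.Bool using (Bool; true; false; if_then_else_)
open import Data.Product using (_×_; _,_; proj₁; proj₂; ∃)
open import Data.Sum using (_⊎_; inj₁; inj₂)
open import Function using (_∘_; _$_; const)
open import Function.Definitions using (Injective)
open import Relation.Nullary using (¬_; Dec; yes; no; contradiction)
open import Relation.Nullary.Decidable using (¬?; decidable-stable)
import Relation.Nullary.Decidable as Dec
open import Relation.Unary using (Pred; Decidable)
open import Relation.Binary.Bundles using (Setoid)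
open import Relation.Binary.PropositionalEquality
import Relation.Binary.Reasoning.Setoid as SetoidReasoning

sum-zero : ∀ {n} {f : Fin n → ℤ} → (∀ i → f i ≡ 0ℤ) → sum f ≡ 0ℤ
sum-zero {n} f≗0 = trans (sum-cong-≗ f≗0) (sum-replicate-zero n)

sum-single : ∀ {n} (f : Fin n → ℤ) i → (∀ t → t ≢ i → f t ≡ 0ℤ) → sum f ≡ f i
sum-single {suc n} f i vanish = begin
  sum f                       ≡⟨ sum-remove f ⟩
  f i + sum (f ∘ punchIn i)   ≡⟨ cong (_+_ (f i)) (sum-zero (λ t → vanish _ (Fin.punchInᵢ≢i i t))) ⟩
  f i + 0ℤ                    ≡⟨ ℤ.+-identityʳ (f i) ⟩
  f i                         ∎
  where open ≡-Reasoning

sum-linear : ∀ {n} α β (f g : Fin n → ℤ) →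
             sum (λ i → α * f i + β * g i) ≡ α * sum f + β * sum g
sum-linear α β f g = begin
  sum (λ i → α * f i + β * g i)             ≡⟨ ∑-distrib-+ (λ i → α * f i) (λ i → β * g i) ⟩
  sum (λ i → α * f i) + sum (λ i → β * g i) ≡⟨ cong₂ _+_ (*-distribˡ-sum α f) (*-distribˡ-sum β g) ⟨
  α * sum f + β * sum g                     ∎
  where open ≡-Reasoning

sum-neg : ∀ {n} (f : Fin n → ℤ) → sum (λ i → - f i) ≡ - sum f
sum-neg f = begin
  sum (λ i → - f i)          ≡⟨ sum-cong-≗ (λ i → ℤ.-1*i≡-i (f i)) ⟨
  sum (λ i → -[1+ 0 ] * f i) ≡⟨ *-distribˡ-sum -[1+ 0 ] f ⟨
  -[1+ 0 ] * sum f           ≡⟨ ℤ.-1*i≡-i (sum f) ⟩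
  - sum f                    ∎
  where open ≡-Reasoning

sum-transposed : ∀ {n} (f g : Fin n → ℤ) i j → f i ≡ g j → f j ≡ g i →
                 (∀ t → t ≢ i → t ≢ j → f t ≡ g t) → sum f ≡ sum g
sum-transposed f g i j fi fj fo = trans (sum-cong-≗ f≗gτ) (sym (∑-permute g (transpose i j)))
  where
  f≗gτ : ∀ t → f t ≡ g (transpose i j ⟨$⟩ʳ t)
  f≗gτ t with t ≟ i
  ... | yes refl = fi
  ... | no t≢i with t ≟ j
  ...   | yes refl = fj
  ...   | no t≢j = fo t t≢i t≢j

-- Determinants

Matrix : ℕ → Set
Matrix n = Fin n → Fin n → ℤ

sign : ℕ → ℤ
sign zero    = 1ℤ
sign (suc i) = - sign i

minor : ∀ {n} → Fin (suc n) → Matrix (suc n) → Matrix n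
minor i M a b = M (punchIn i a) (suc b)

det : ∀ {n} → Matrix n → ℤ
det {zero}  M = 1ℤ
det {suc n} M = sum λ i → sign (toℕ i) * M i zero * det (minor i M)

_≗₂_ : ∀ {n} → Matrix n → Matrix n → Set
M ≗₂ N = ∀ a b → M a b ≡ N a b

det-cong : ∀ {n} {M N : Matrix n} → M ≗₂ N → det M ≡ det N
det-cong {zero}  M≗N = refl
det-cong {suc n} M≗N = sum-cong-≗ λ i →
  cong₂ (λ x y → sign (toℕ i) * x * y) (M≗N i zero) (det-cong (λ a b → M≗N (punchIn i a) (suc b)))

AgreeOff : ∀ {n} → Fin n → Matrix n → Matrix n → Set
AgreeOff r M N = ∀ a → a ≢ r → ∀ b → M a b ≡ N a b

minor-agreeOff-same : ∀ {n} {M N : Matrix (suc n)} r → AgreeOff r M N → minor r M ≗₂ minor r N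
minor-agreeOff-same r M≈N a b = M≈N (punchIn r a) (Fin.punchInᵢ≢i r a) (suc b)

minor-agreeOff : ∀ {n} {M N : Matrix (suc n)} {r t} (t≢r : t ≢ r) →
                 AgreeOff r M N → AgreeOff (punchOut t≢r) (minor t M) (minor t N)
minor-agreeOff {t = t} t≢r M≈N a a≢r b = M≈N (punchIn t a) tᵃ≢r (suc b)
  where
  tᵃ≢r : punchIn t a ≢ _
  tᵃ≢r e = a≢r (Fin.punchIn-injective t a _ (trans e (sym (Fin.punchIn-punchOut t≢r))))

det-linear-row : ∀ {n} (M M₁ M₂ : Matrix n) r α β → AgreeOff r M₁ M → AgreeOff r M₂ M →
                 (∀ b → M r b ≡ α * M₁ r b + β * M₂ r b) →
                 det M ≡ α * det M₁ + β * det M₂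
det-linear-row {suc n} M M₁ M₂ r α β M₁≈M M₂≈M Mr =
  trans (sum-cong-≗ term) (sum-linear α β (T M₁) (T M₂))
  where
  T : Matrix (suc n) → Fin (suc n) → ℤ
  T N t = sign (toℕ t) * N t zero * det (minor t N)
  term : ∀ t → T M t ≡ α * T M₁ t + β * T M₂ t
  term t with t ≟ r
  ... | yes refl = begin
    s * M t zero * det (minor t M)                     ≡⟨ cong (λ x → s * x * det (minor t M)) (Mr zero) ⟩
    s * (α * x₁ + β * x₂) * det (minor t M)             ≡⟨ distrib s x₁ x₂ (det (minor t M)) α β ⟩
    α * (s * x₁ * det (minor t M)) + β * (s * x₂ * det (minor t M))
      ≡⟨ cong₂ (λ d₁ d₂ → α * (s * x₁ * d₁) + β * (s * x₂ * d₂))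
               (det-cong (minor-agreeOff-same t M₁≈M)) (det-cong (minor-agreeOff-same t M₂≈M)) ⟨
    α * T M₁ t + β * T M₂ t                             ∎
    where
    open ≡-Reasoning
    s = sign (toℕ t)
    x₁ = M₁ t zero
    x₂ = M₂ t zero
    distrib : ∀ s x₁ x₂ d α β → s * (α * x₁ + β * x₂) * d ≡ α * (s * x₁ * d) + β * (s * x₂ * d)
    distrib = solve-∀
  ... | no t≢r = begin
    s * M t zero * det (minor t M)
      ≡⟨ cong (s * M t zero *_) minor-linear ⟩
    s * M t zero * (α * det (minor t M₁) + β * det (minor t M₂))
      ≡⟨ distrib s (M t zero) (det (minor t M₁)) (det (minor t M₂)) α β ⟩
    α * (s * M t zero * det (minor t M₁)) + β * (s * M t zero * det (minor t M₂))
      ≡⟨ cong₂ (λ x₁ x₂ → α * (s * x₁ * det (minor t M₁)) + β * (s * x₂ * det (minor t M₂)))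
               (M₁≈M t t≢r zero) (M₂≈M t t≢r zero) ⟨
    α * T M₁ t + β * T M₂ t ∎
    where
    open ≡-Reasoning
    s = sign (toℕ t)
    distrib : ∀ s x d₁ d₂ α β → s * x * (α * d₁ + β * d₂) ≡ α * (s * x * d₁) + β * (s * x * d₂)
    distrib = solve-∀
    minor-linear : det (minor t M) ≡ α * det (minor t M₁) + β * det (minor t M₂)
    minor-linear = det-linear-row (minor t M) (minor t M₁) (minor t M₂) (punchOut t≢r) α β
      (minor-agreeOff t≢r M₁≈M) (minor-agreeOff t≢r M₂≈M)
      (λ b → subst (λ a → M a (suc b) ≡ α * M₁ a (suc b) + β * M₂ a (suc b))
                   (sym (Fin.punchIn-punchOut t≢r)) (Mr (suc b)))

data Adjacent : ∀ {n} → Fin n → Fin n → Set where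
  zero-one : ∀ {n} → Adjacent {suc (suc n)} zero (suc zero)
  suc-suc  : ∀ {n} {i j : Fin n} → Adjacent i j → Adjacent (suc i) (suc j)

adjacent-toℕ : ∀ {n} {i j : Fin n} → Adjacent i j → toℕ j ≡ suc (toℕ i)
adjacent-toℕ zero-one      = refl
adjacent-toℕ (suc-suc adj) = cong suc (adjacent-toℕ adj)

toℕ-adjacent : ∀ {n} {i j : Fin n} → toℕ j ≡ suc (toℕ i) → Adjacent i j
toℕ-adjacent {i = zero}  {suc zero} refl = zero-one
toℕ-adjacent {i = suc i} {suc j}    e    = suc-suc (toℕ-adjacent (ℕ.suc-injective e))

adjacent-≢ : ∀ {n} {i j : Fin n} → Adjacent i j → i ≢ j
adjacent-≢ adj refl = ℕ.<-irrefl (adjacent-toℕ adj) (ℕ.n<1+n _)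

punchIn-adjacent : ∀ {n} {i j : Fin (suc n)} → Adjacent i j → ∀ a →
                   (punchIn i a ≡ j × punchIn j a ≡ i) ⊎ punchIn i a ≡ punchIn j a
punchIn-adjacent zero-one      zero    = inj₁ (refl , refl)
punchIn-adjacent zero-one      (suc a) = inj₂ refl
punchIn-adjacent (suc-suc adj) zero    = inj₂ refl
punchIn-adjacent (suc-suc adj) (suc a) with punchIn-adjacent adj a
... | inj₁ (e₁ , e₂) = inj₁ (cong suc e₁ , cong suc e₂)
... | inj₂ e         = inj₂ (cong suc e)

punchOut-adjacent : ∀ {n} {i j t : Fin (suc n)} → Adjacent i j → (t≢i : t ≢ i) (t≢j : t ≢ j) →
                    Adjacent (punchOut t≢i) (punchOut t≢j)
punchOut-adjacent {t = zero}        zero-one      t≢i t≢j = contradiction refl t≢i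
punchOut-adjacent {t = suc zero}    zero-one      t≢i t≢j = contradiction refl t≢j
punchOut-adjacent {n = suc (suc n)} {t = suc (suc t)} zero-one t≢i t≢j = zero-one
punchOut-adjacent {t = zero}        (suc-suc adj) t≢i t≢j = adj
punchOut-adjacent {n = suc n} {t = suc t} (suc-suc adj) t≢i t≢j =
  suc-suc (punchOut-adjacent adj (t≢i ∘ cong suc) (t≢j ∘ cong suc))

record RowsSwapped {n} (i j : Fin n) (M M′ : Matrix n) : Set where
  field
    at-i      : ∀ b → M′ i b ≡ M j b
    at-j      : ∀ b → M′ j b ≡ M i b
    elsewhere : ∀ a → a ≢ i → a ≢ j → ∀ b → M′ a b ≡ M a b

rowsSwapped-sym : ∀ {n} {i j : Fin n} {M M′} → RowsSwapped i j M M′ → RowsSwapped i j M′ M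
rowsSwapped-sym sw = record
  { at-i      = sym ∘ at-j
  ; at-j      = sym ∘ at-i
  ; elsewhere = λ a a≢i a≢j → sym ∘ elsewhere a a≢i a≢j
  }
  where open RowsSwapped sw

minor-rowsSwapped : ∀ {n} {i j : Fin (suc n)} {M M′} → Adjacent i j → RowsSwapped i j M M′ →
                    minor i M′ ≗₂ minor j M
minor-rowsSwapped {i = i} {j} {M} {M′} adj sw a b with punchIn-adjacent adj a
... | inj₁ (iᵃ≡j , jᵃ≡i) = trans (cong (λ x → M′ x (suc b)) iᵃ≡j)
                             (trans (at-j (suc b)) (cong (λ x → M x (suc b)) (sym jᵃ≡i)))
  where open RowsSwapped sw
... | inj₂ iᵃ≡jᵃ = trans (elsewhere _ (Fin.punchInᵢ≢i i a) iᵃ≢j (suc b)) (cong (λ x → M x (suc b)) iᵃ≡jᵃ)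
  where
  open RowsSwapped sw
  iᵃ≢j : punchIn i a ≢ j
  iᵃ≢j e = Fin.punchInᵢ≢i j a (trans (sym iᵃ≡jᵃ) e)

minor-rowsSwapped-off : ∀ {n} {i j t : Fin (suc n)} {M M′} (t≢i : t ≢ i) (t≢j : t ≢ j) →
                        RowsSwapped i j M M′ →
                        RowsSwapped (punchOut t≢i) (punchOut t≢j) (minor t M) (minor t M′)
minor-rowsSwapped-off {t = t} {M} {M′} t≢i t≢j sw = record
  { at-i      = λ b → subst₂ (λ x y → M′ x (suc b) ≡ M y (suc b))
                        (sym (Fin.punchIn-punchOut t≢i)) (sym (Fin.punchIn-punchOut t≢j)) (at-i (suc b))
  ; at-j      = λ b → subst₂ (λ x y → M′ x (suc b) ≡ M y (suc b))
                        (sym (Fin.punchIn-punchOut t≢j)) (sym (Fin.punchIn-punchOut t≢i)) (at-j (suc b))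
  ; elsewhere = λ a a≢i a≢j b → elsewhere (punchIn t a) (avoid t≢i a≢i) (avoid t≢j a≢j) (suc b)
  }
  where
  open RowsSwapped sw
  avoid : ∀ {r} (t≢r : t ≢ r) {a} → a ≢ punchOut t≢r → punchIn t a ≢ r
  avoid t≢r a≢r e = a≢r (Fin.punchIn-injective t _ _ (trans e (sym (Fin.punchIn-punchOut t≢r))))

det-swap-adjacent : ∀ {n} {i j : Fin n} {M M′} → Adjacent i j → RowsSwapped i j M M′ → det M′ ≡ - det M
det-swap-adjacent {suc n} {i} {j} {M} {M′} adj sw = begin
  det M′                 ≡⟨ sum-transposed (T M′) (λ t → - T M t) i j term-i term-j term-elsewhere ⟩
  sum (λ t → - T M t)    ≡⟨ sum-neg (T M) ⟩
  - det M                ∎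
  where
  open ≡-Reasoning
  open RowsSwapped sw
  T : Matrix (suc n) → Fin (suc n) → ℤ
  T N t = sign (toℕ t) * N t zero * det (minor t N)
  flip-sign : ∀ s x d → - (- s * x * d) ≡ s * x * d
  flip-sign = solve-∀
  negate-outer : ∀ s x d → - s * x * d ≡ - (s * x * d)
  negate-outer = solve-∀
  sign-j : sign (toℕ j) ≡ - sign (toℕ i)
  sign-j = cong sign (adjacent-toℕ adj)
  term-i : T M′ i ≡ - T M j
  term-i = begin
    sign (toℕ i) * M′ i zero * det (minor i M′)
      ≡⟨ cong₂ (λ x d → sign (toℕ i) * x * d) (at-i zero) (det-cong (minor-rowsSwapped adj sw)) ⟩
    sign (toℕ i) * M j zero * det (minor j M)
      ≡⟨ flip-sign (sign (toℕ i)) (M j zero) (det (minor j M)) ⟨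
    - (- sign (toℕ i) * M j zero * det (minor j M))
      ≡⟨ cong (λ s → - (s * M j zero * det (minor j M))) sign-j ⟨
    - T M j ∎
  term-j : T M′ j ≡ - T M i
  term-j = begin
    sign (toℕ j) * M′ j zero * det (minor j M′)
      ≡⟨ cong₂ (λ x d → sign (toℕ j) * x * d) (at-j zero)
               (det-cong (λ a b → sym (minor-rowsSwapped adj (rowsSwapped-sym sw) a b))) ⟩
    sign (toℕ j) * M i zero * det (minor i M)
      ≡⟨ cong (λ s → s * M i zero * det (minor i M)) sign-j ⟩
    - sign (toℕ i) * M i zero * det (minor i M)
      ≡⟨ negate-outer (sign (toℕ i)) (M i zero) (det (minor i M)) ⟩
    - T M i ∎
  term-elsewhere : ∀ t → t ≢ i → t ≢ j → T M′ t ≡ - T M t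
  term-elsewhere t t≢i t≢j = begin
    sign (toℕ t) * M′ t zero * det (minor t M′)
      ≡⟨ cong₂ (λ x d → sign (toℕ t) * x * d) (elsewhere t t≢i t≢j zero)
               (det-swap-adjacent (punchOut-adjacent adj t≢i t≢j) (minor-rowsSwapped-off t≢i t≢j sw)) ⟩
    sign (toℕ t) * M t zero * - det (minor t M)
      ≡⟨ ℤ.neg-distribʳ-* (sign (toℕ t) * M t zero) (det (minor t M)) ⟨
    - T M t ∎

x≡-x⇒x≡0 : ∀ {x} → x ≡ - x → x ≡ 0ℤ
x≡-x⇒x≡0 {+0}       _  = refl
x≡-x⇒x≡0 {+[1+ _ ]} ()
x≡-x⇒x≡0 { -[1+ _ ]} ()

det-equal-adjacent-rows : ∀ {n} {i j : Fin n} {M} → Adjacent i j → (∀ b → M i b ≡ M j b) → det M ≡ 0ℤ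
det-equal-adjacent-rows adj Mi≡Mj = x≡-x⇒x≡0 (det-swap-adjacent adj (record
  { at-i      = Mi≡Mj
  ; at-j      = sym ∘ Mi≡Mj
  ; elsewhere = λ _ _ _ _ → refl
  }))

swapRows : ∀ {n} → Fin n → Fin n → Matrix n → Matrix n
swapRows i j M = updateAt (updateAt M i (const (M j))) j (const (M i))

swapRows-rowsSwapped : ∀ {n} {i j : Fin n} (M : Matrix n) → i ≢ j → RowsSwapped i j M (swapRows i j M)
swapRows-rowsSwapped {i = i} {j} M i≢j = record
  { at-i      = λ b → cong (_$ b) (trans (updateAt-minimal i j _ i≢j) (updateAt-updates i M))
  ; at-j      = λ b → cong (_$ b) (updateAt-updates j _)
  ; elsewhere = λ a a≢i a≢j b → cong (_$ b) (trans (updateAt-minimal a j _ a≢j) (updateAt-minimal a i M a≢i))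
  }

det-equal-rows : ∀ d {n} (M : Matrix n) {i j} → toℕ j ≡ suc (d +ℕ toℕ i) →
                 (∀ b → M i b ≡ M j b) → det M ≡ 0ℤ
det-equal-rows zero    M     e Mi≡Mj = det-equal-adjacent-rows (toℕ-adjacent e) Mi≡Mj
det-equal-rows (suc d) M {i} {suc j} e Mi≡Mj =
  ℤ.neg-injective (trans (sym (det-swap-adjacent adj sw)) (det-equal-rows d M′ toℕ-j Mi≡M′j))
  where
  adj : Adjacent (inject₁ j) (suc j)
  adj = toℕ-adjacent (cong suc (sym (Fin.toℕ-inject₁ j)))
  M′ = swapRows (inject₁ j) (suc j) M
  sw = swapRows-rowsSwapped M (adjacent-≢ adj)
  toℕ-j : toℕ (inject₁ j) ≡ suc (d +ℕ toℕ i)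
  toℕ-j = trans (Fin.toℕ-inject₁ j) (ℕ.suc-injective e)
  i≢j : i ≢ inject₁ j
  i≢j refl = ℕ.<-irrefl toℕ-j (s≤s (ℕ.m≤n+m (toℕ i) d))
  i≢sj : i ≢ suc j
  i≢sj refl = ℕ.<-irrefl e (s≤s (ℕ.m≤n+m (toℕ i) (suc d)))
  Mi≡M′j : ∀ b → M′ i b ≡ M′ (inject₁ j) b
  Mi≡M′j b = trans (RowsSwapped.elsewhere sw i i≢j i≢sj b) (trans (Mi≡Mj b) (sym (RowsSwapped.at-i sw b)))

det-equal-row-zero : ∀ {n} (M : Matrix (suc n)) (r : Fin n) → (∀ b → M zero b ≡ M (suc r) b) → det M ≡ 0ℤ
det-equal-row-zero M r = det-equal-rows (toℕ r) M (cong suc (sym (ℕ.+-identityʳ (toℕ r))))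

det-eliminate-row : ∀ {n} (M M′ : Matrix (suc n)) (r : Fin n) a c → AgreeOff (suc r) M′ M →
                    (∀ b → M′ (suc r) b ≡ a * M (suc r) b - c * M zero b) → det M′ ≡ a * det M
det-eliminate-row M M′ r a c M′≈M M′r = begin
  det M′                   ≡⟨ det-linear-row M′ M N (suc r) a (- c) M≈M′ N≈M′ row ⟩
  a * det M + - c * det N  ≡⟨ cong (λ x → a * det M + - c * x) (det-equal-row-zero N r N₀≡Nr) ⟩
  a * det M + - c * 0ℤ     ≡⟨ cancel (det M) ⟩
  a * det M                ∎
  where
  open ≡-Reasoning
  N = updateAt M (suc r) (const (M zero))
  cancel : ∀ d → a * d + - c * 0ℤ ≡ a * d
  cancel d = trans (cong (_+_ (a * d)) (ℤ.*-zeroʳ (- c))) (ℤ.+-identityʳ (a * d))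
  M≈M′ : AgreeOff (suc r) M M′
  M≈M′ x x≢r b = sym (M′≈M x x≢r b)
  N≈M′ : AgreeOff (suc r) N M′
  N≈M′ x x≢r b = trans (cong (_$ b) (updateAt-minimal x (suc r) M x≢r)) (M≈M′ x x≢r b)
  row : ∀ b → M′ (suc r) b ≡ a * M (suc r) b + - c * N (suc r) b
  row b = begin
    M′ (suc r) b                         ≡⟨ M′r b ⟩
    a * M (suc r) b - c * M zero b       ≡⟨ cong (_+_ (a * M (suc r) b)) (ℤ.neg-distribˡ-* c (M zero b)) ⟩
    a * M (suc r) b + - c * M zero b     ≡⟨ cong (λ x → a * M (suc r) b + - c * x b) (updateAt-updates (suc r) M) ⟨
    a * M (suc r) b + - c * N (suc r) b  ∎
  N₀≡Nr : ∀ b → N zero b ≡ N (suc r) b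
  N₀≡Nr b = cong (_$ b) (trans (updateAt-minimal zero (suc r) {const (M zero)} M (λ ()))
                               (sym (updateAt-updates (suc r) M)))

condense : ∀ {n} → Matrix (suc n) → Matrix n
condense N a b = N zero zero * N (suc a) (suc b) - N (suc a) zero * N zero (suc b)

condenseRowsBelow : ∀ {n} → ℕ → Matrix (suc n) → Matrix (suc n)
condenseRowsBelow k N zero    b = N zero b
condenseRowsBelow k N (suc a) b with toℕ a <? k
... | yes _ = N zero zero * N (suc a) b - N (suc a) zero * N zero b
... | no  _ = N (suc a) b

condenseRowsBelow-agreeOff : ∀ {n} (N : Matrix (suc n)) {r : Fin n} {k} → toℕ r ≡ k →
                             AgreeOff (suc r) (condenseRowsBelow (suc k) N) (condenseRowsBelow k N)
condenseRowsBelow-agreeOff N         e zero    _    b = refl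
condenseRowsBelow-agreeOff N {r} {k} e (suc a) a≢r b with toℕ a <? suc k | toℕ a <? k
... | yes _     | yes _   = refl
... | no  _     | no  _   = refl
... | no  a≮1+k | yes a<k = contradiction (ℕ.m<n⇒m<1+n a<k) a≮1+k
... | yes a<1+k | no  a≮k = contradiction (Fin.toℕ-injective (trans a≡k (sym e))) (a≢r ∘ cong suc)
  where
  a≡k : toℕ a ≡ k
  a≡k = ℕ.≤-antisym (ℕ.≤-pred a<1+k) (ℕ.≮⇒≥ a≮k)

condenseRowsBelow-row : ∀ {n} (N : Matrix (suc n)) {r : Fin n} {k} → toℕ r ≡ k → ∀ b →
                        condenseRowsBelow (suc k) N (suc r) b
                          ≡ N zero zero * condenseRowsBelow k N (suc r) b - N (suc r) zero * condenseRowsBelow k N zero b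
condenseRowsBelow-row N {r} {k} e b with toℕ r <? suc k | toℕ r <? k
... | yes _   | no  _   = refl
... | no  r≮  | _       = contradiction (s≤s (ℕ.≤-reflexive e)) r≮
... | yes _   | yes r<k = contradiction r<k (ℕ.<-irrefl e)

condenseRowsBelow-all : ∀ {n} (N : Matrix (suc n)) a b →
                        condenseRowsBelow n N (suc a) b ≡ N zero zero * N (suc a) b - N (suc a) zero * N zero b
condenseRowsBelow-all {n} N a b with toℕ a <? n
... | yes _ = refl
... | no a≮n = contradiction (Fin.toℕ<n a) a≮n

det-condenseRowsBelow : ∀ {n} (N : Matrix (suc n)) k → k ≤ n →
                        det (condenseRowsBelow k N) ≡ N zero zero ^ k * det N
det-condenseRowsBelow N zero    _   = trans (det-cong unchanged) (sym (ℤ.*-identityˡ (det N)))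
  where
  unchanged : condenseRowsBelow zero N ≗₂ N
  unchanged zero    b = refl
  unchanged (suc a) b = refl
det-condenseRowsBelow {n} N (suc k) k<n = begin
  det (condenseRowsBelow (suc k) N)
    ≡⟨ det-eliminate-row (condenseRowsBelow k N) _ r (N zero zero) (N (suc r) zero)
                         (condenseRowsBelow-agreeOff N toℕ-r) (condenseRowsBelow-row N toℕ-r) ⟩
  N zero zero * det (condenseRowsBelow k N)
    ≡⟨ cong (N zero zero *_) (det-condenseRowsBelow N k (ℕ.<⇒≤ k<n)) ⟩
  N zero zero * (N zero zero ^ k * det N)
    ≡⟨ ℤ.*-assoc (N zero zero) (N zero zero ^ k) (det N) ⟨
  N zero zero ^ suc k * det N ∎
  where
  open ≡-Reasoning
  r : Fin n
  r = Data.Fin.fromℕ< k<n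
  toℕ-r : toℕ r ≡ k
  toℕ-r = Fin.toℕ-fromℕ< k<n

det-condense : ∀ {n} (N : Matrix (suc n)) → N zero zero * det (condense N) ≡ N zero zero ^ n * det N
det-condense {n} N = begin
  N zero zero * det (condense N)             ≡⟨ cong (N zero zero *_) (det-cong minor₀) ⟨
  N zero zero * det (minor zero P)           ≡⟨ cong (_* det (minor zero P)) (ℤ.*-identityˡ (N zero zero)) ⟨
  sign 0 * P zero zero * det (minor zero P)  ≡⟨ sum-single _ zero vanish ⟨
  det P                                      ≡⟨ det-condenseRowsBelow N n ℕ.≤-refl ⟩
  N zero zero ^ n * det N                    ∎
  where
  open ≡-Reasoning
  P = condenseRowsBelow n N
  minor₀ : minor zero P ≗₂ condense N
  minor₀ a b = condenseRowsBelow-all N a (suc b)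
  vanish : ∀ t → t ≢ zero → sign (toℕ t) * P t zero * det (minor t P) ≡ 0ℤ
  vanish zero    t≢0 = contradiction refl t≢0
  vanish (suc a) _   = begin
    sign (suc (toℕ a)) * P (suc a) zero * det (minor (suc a) P)
      ≡⟨ cong (λ x → sign (suc (toℕ a)) * x * det (minor (suc a) P)) (condenseRowsBelow-all N a zero) ⟩
    sign (suc (toℕ a)) * (N zero zero * N (suc a) zero - N (suc a) zero * N zero zero) * det (minor (suc a) P)
      ≡⟨ commutator-vanishes (sign (suc (toℕ a))) (N zero zero) (N (suc a) zero) (det (minor (suc a) P)) ⟩
    0ℤ ∎
    where
    commutator-vanishes : ∀ s x y d → s * (x * y - y * x) * d ≡ 0ℤ
    commutator-vanishes = solve-∀

det₁ : (M : Matrix 1) → det M ≡ M zero zero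
det₁ M = expand (M zero zero)
  where
  expand : ∀ x → 1ℤ * x * 1ℤ + 0ℤ ≡ x
  expand = solve-∀

-- Determinants of 0/1 matrices

IsBit : ℤ → Set
IsBit x = x ≡ 0ℤ ⊎ x ≡ 1ℤ

IsBinary : ∀ {n} → Matrix n → Set
IsBinary M = ∀ a b → IsBit (M a b)

∣bit∣≤1 : ∀ {x} → IsBit x → ∣ x ∣ ≤ 1
∣bit∣≤1 (inj₁ refl) = z≤n
∣bit∣≤1 (inj₂ refl) = ℕ.≤-refl

bit-* : ∀ {x y} → IsBit x → IsBit y → IsBit (x * y)
bit-* (inj₁ refl) _           = inj₁ refl
bit-* (inj₂ refl) (inj₁ refl) = inj₁ refl
bit-* (inj₂ refl) (inj₂ refl) = inj₂ refl

∣bit-bit∣≤1 : ∀ {x y} → IsBit x → IsBit y → ∣ x - y ∣ ≤ 1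
∣bit-bit∣≤1 (inj₁ refl) (inj₁ refl) = z≤n
∣bit-bit∣≤1 (inj₁ refl) (inj₂ refl) = ℕ.≤-refl
∣bit-bit∣≤1 (inj₂ refl) (inj₁ refl) = ℕ.≤-refl
∣bit-bit∣≤1 (inj₂ refl) (inj₂ refl) = z≤n

∣sign∣≡1 : ∀ i → ∣ sign i ∣ ≡ 1
∣sign∣≡1 zero    = refl
∣sign∣≡1 (suc i) = trans (ℤ.∣-i∣≡∣i∣ (sign i)) (∣sign∣≡1 i)

∣sum∣≤ : ∀ {n} (f : Fin n → ℤ) {c} → (∀ i → ∣ f i ∣ ≤ c) → ∣ sum f ∣ ≤ n *ℕ c
∣sum∣≤ {zero}  f f≤c = z≤n
∣sum∣≤ {suc n} f f≤c = ℕ.≤-trans (ℤ.∣i+j∣≤∣i∣+∣j∣ (f zero) (sum (f ∘ suc)))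
                                  (ℕ.+-mono-≤ (f≤c zero) (∣sum∣≤ (f ∘ suc) (f≤c ∘ suc)))

∣det∣≤-laplace : ∀ {n} (M : Matrix (suc n)) {c} → IsBinary M →
                 (∀ t → ∣ det (minor t M) ∣ ≤ c) → ∣ det M ∣ ≤ suc n *ℕ c
∣det∣≤-laplace M {c} bin minor≤c = ∣sum∣≤ (λ t → sign (toℕ t) * M t zero * det (minor t M)) λ t → begin
  ∣ sign (toℕ t) * M t zero * det (minor t M) ∣
    ≡⟨ ℤ.abs-* (sign (toℕ t) * M t zero) _ ⟩
  ∣ sign (toℕ t) * M t zero ∣ *ℕ ∣ det (minor t M) ∣
    ≡⟨ cong (_*ℕ ∣ det (minor t M) ∣) (ℤ.abs-* (sign (toℕ t)) (M t zero)) ⟩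
  ∣ sign (toℕ t) ∣ *ℕ ∣ M t zero ∣ *ℕ ∣ det (minor t M) ∣
    ≡⟨ cong (λ s → s *ℕ ∣ M t zero ∣ *ℕ ∣ det (minor t M) ∣) (∣sign∣≡1 (toℕ t)) ⟩
  1 *ℕ ∣ M t zero ∣ *ℕ ∣ det (minor t M) ∣
    ≤⟨ ℕ.*-mono-≤ (ℕ.*-monoʳ-≤ 1 (∣bit∣≤1 (bin t zero))) (minor≤c t) ⟩
  1 *ℕ 1 *ℕ c
    ≡⟨ ℕ.*-identityˡ c ⟩
  c ∎
  where open ℕ.≤-Reasoning

-- ⌈ n! / 2 ⌉
halfFactorial : ℕ → ℕ
halfFactorial 0 = 1
halfFactorial 1 = 1
halfFactorial 2 = 1
halfFactorial (suc (suc (suc n))) = suc (suc (suc n)) *ℕ halfFactorial (suc (suc n))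

∣det∣≤halfFactorial : ∀ {n} (M : Matrix n) → IsBinary M → ∣ det M ∣ ≤ halfFactorial n
∣det∣≤halfFactorial {0} M bin = ℕ.≤-refl
∣det∣≤halfFactorial {1} M bin = subst (λ d → ∣ d ∣ ≤ 1) (sym (det₁ M)) (∣bit∣≤1 (bin zero zero))
∣det∣≤halfFactorial {2} M bin = subst (λ d → ∣ d ∣ ≤ 1) (sym (expand (M 0F 0F) (M 1F 1F) (M 1F 0F) (M 0F 1F)))
  (∣bit-bit∣≤1 (bit-* (bin 0F 0F) (bin 1F 1F)) (bit-* (bin 1F 0F) (bin 0F 1F)))
  where
  expand : ∀ a d c b → 1ℤ * a * (1ℤ * d * 1ℤ + 0ℤ) + (- 1ℤ * c * (1ℤ * b * 1ℤ + 0ℤ) + 0ℤ) ≡ a * d - c * b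
  expand = solve-∀
∣det∣≤halfFactorial {suc (suc (suc n))} M bin =
  ∣det∣≤-laplace M bin (λ t → ∣det∣≤halfFactorial (minor t M) (λ a b → bin (punchIn t a) (suc b)))

2*halfFactorial≤! : ∀ n → 2 *ℕ halfFactorial (suc (suc n)) ≤ suc (suc n) !
2*halfFactorial≤! zero    = ℕ.≤-refl
2*halfFactorial≤! (suc n) = begin
  2 *ℕ ((3 +ℕ n) *ℕ h) ≡⟨ ℕ.*-assoc 2 (3 +ℕ n) h ⟨
  2 *ℕ (3 +ℕ n) *ℕ h   ≡⟨ cong (_*ℕ h) (ℕ.*-comm 2 (3 +ℕ n)) ⟩
  (3 +ℕ n) *ℕ 2 *ℕ h   ≡⟨ ℕ.*-assoc (3 +ℕ n) 2 h ⟩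
  (3 +ℕ n) *ℕ (2 *ℕ h) ≤⟨ ℕ.*-monoʳ-≤ (3 +ℕ n) (2*halfFactorial≤! n) ⟩
  (3 +ℕ n) *ℕ (2 +ℕ n) ! ∎
  where
  open ℕ.≤-Reasoning
  h = halfFactorial (2 +ℕ n)

!-mono-≤ : ∀ {m n} → m ≤ n → m ! ≤ n !
!-mono-≤ {m} {n} m≤n = ℕ.∣⇒≤ {{ℕ._!≢0 n}} (ℕ.∣-trans (ℕ.m∣m*n ((n ∸ m) !)) (k![n∸k]!∣n! m≤n))

halfFactorial-< : ∀ {s k q} → s ≤ k → k ! < 2 *ℕ q → 2 ≤ q → halfFactorial s < q
halfFactorial-< {0}             _   _      2≤q = 2≤q
halfFactorial-< {1}             _   _      2≤q = 2≤q
halfFactorial-< {suc (suc s)} {k} {q} s≤k k!<2q _ = ℕ.*-cancelˡ-< 2 (halfFactorial (suc (suc s))) q (begin-strict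
  2 *ℕ halfFactorial (suc (suc s)) ≤⟨ 2*halfFactorial≤! s ⟩
  suc (suc s) !                    ≤⟨ !-mono-≤ s≤k ⟩
  k !                              <⟨ k!<2q ⟩
  2 *ℕ q                           ∎)
  where open ℕ.≤-Reasoning

-- Coprimality and congruences

coprime-∣⇒coprime : ∀ {m x y} → Coprime m y → x ∣ℕ y → Coprime m x
coprime-∣⇒coprime cop x∣y (d∣m , d∣x) = cop (d∣m , ℕ.∣-trans d∣x x∣y)

coprime-* : ∀ {m x y} → Coprime m x → Coprime m y → Coprime m (x *ℕ y)
coprime-* copx copy (d∣m , d∣xy) =
  copy (d∣m , coprime-divisor (λ (e∣d , e∣x) → copx (ℕ.∣-trans e∣d d∣m , e∣x)) d∣xy)

coprime-1 : ∀ {m} → Coprime m 1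
coprime-1 (_ , d∣1) = ℕ.∣1⇒≡1 d∣1

coprime-∣*∣ : ∀ {m} x y → Coprime m ∣ x ∣ → Coprime m ∣ y ∣ → Coprime m ∣ x * y ∣
coprime-∣*∣ x y copx copy = subst (Coprime _) (sym (ℤ.abs-* x y)) (coprime-* copx copy)

coprime-∣^∣ : ∀ {m} x k → Coprime m ∣ x ∣ → Coprime m ∣ x ^ k ∣
coprime-∣^∣ x zero    copx = coprime-1
coprime-∣^∣ x (suc k) copx = coprime-∣*∣ x (x ^ k) copx (coprime-∣^∣ x k copx)

no-common-prime⇒coprime : ∀ {m n} .{{_ : NonZero m}} →
                          (∀ q → Prime q → q ∣ℕ m → ¬ q ∣ℕ n) → Coprime m n
no-common-prime⇒coprime {m} _ {0} (0∣m , _) = contradiction (ℕ.0∣⇒≡0 0∣m) (≢-nonZero⁻¹ m)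
no-common-prime⇒coprime _ {1} _ = refl
no-common-prime⇒coprime noCommon {suc (suc d)} (d∣m , d∣n) with factorise (suc (suc d))
... | record { factors = List.[] ; isFactorisation = () }
... | record { factors = q List.∷ _ ; isFactorisation = eq ; factorsPrime = prime-q All.∷ _ } =
  contradiction (ℕ.∣-trans q∣d d∣n) (noCommon q prime-q (ℕ.∣-trans q∣d d∣m))
  where
  q∣d : q ∣ℕ suc (suc d)
  q∣d = subst (q ∣ℕ_) (sym eq) (ℕ.m∣m*n _)

infix 4 _≡_modulo_
record _≡_modulo_ (x y : ℤ) (m : ℕ) : Set where
  constructor divides-difference
  field difference-divisible : + m ∣ x - y

open _≡_modulo_

module _ {m : ℕ} where

  ≡⇒≡-modulo : ∀ {x y} → x ≡ y → x ≡ y modulo m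
  ≡⇒≡-modulo {x} refl = divides-difference (subst (+ m ∣_) (sym (ℤ.+-inverseʳ x)) (divides 0ℤ refl))

  modulo-sym : ∀ {x y} → x ≡ y modulo m → y ≡ x modulo m
  modulo-sym {x} {y} (divides-difference m∣x-y) =
    divides-difference (subst (+ m ∣_) (negate x y) (∣m⇒∣-m m∣x-y))
    where
    negate : ∀ x y → - (x - y) ≡ y - x
    negate = solve-∀

  modulo-trans : ∀ {x y z} → x ≡ y modulo m → y ≡ z modulo m → x ≡ z modulo m
  modulo-trans {x} {y} {z} (divides-difference m∣x-y) (divides-difference m∣y-z) =
    divides-difference (subst (+ m ∣_) (telescope x y z) (∣m∣n⇒∣m+n m∣x-y m∣y-z))
    where
    telescope : ∀ x y z → x - y + (y - z) ≡ x - z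
    telescope = solve-∀

  modulo-+ : ∀ {x x′ y y′} → x ≡ x′ modulo m → y ≡ y′ modulo m → x + y ≡ x′ + y′ modulo m
  modulo-+ {x} {x′} {y} {y′} (divides-difference m∣x-x′) (divides-difference m∣y-y′) =
    divides-difference (subst (+ m ∣_) (regroup x x′ y y′) (∣m∣n⇒∣m+n m∣x-x′ m∣y-y′))
    where
    regroup : ∀ x x′ y y′ → x - x′ + (y - y′) ≡ x + y - (x′ + y′)
    regroup = solve-∀

  modulo-*ˡ : ∀ c {x y} → x ≡ y modulo m → c * x ≡ c * y modulo m
  modulo-*ˡ c {x} {y} (divides-difference m∣x-y) =
    divides-difference (subst (+ m ∣_) (distrib c x y) (∣n⇒∣m*n c m∣x-y))
    where
    distrib : ∀ c x y → c * (x - y) ≡ c * x - c * y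
    distrib = solve-∀

  modulo-neg : ∀ {x y} → x ≡ y modulo m → - x ≡ - y modulo m
  modulo-neg {x} {y} (divides-difference m∣x-y) =
    divides-difference (subst (+ m ∣_) (negate x y) (∣m⇒∣-m m∣x-y))
    where
    negate : ∀ x y → - (x - y) ≡ - x - - y
    negate = solve-∀

  modulo-difference : ∀ {x y} → x ≡ y modulo m → x - y ≡ 0ℤ modulo m
  modulo-difference {x} {y} (divides-difference m∣x-y) =
    divides-difference (subst (+ m ∣_) (sym (ℤ.+-identityʳ (x - y))) m∣x-y)

  difference-modulo : ∀ {x y} → x - y ≡ 0ℤ modulo m → x ≡ y modulo m
  difference-modulo {x} {y} (divides-difference m∣x-y-0) =
    divides-difference (subst (+ m ∣_) (ℤ.+-identityʳ (x - y)) m∣x-y-0)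

infix 4 _≡?_modulo_
_≡?_modulo_ : ∀ x y m → Dec (x ≡ y modulo m)
x ≡? y modulo m = Dec.map′ divides-difference difference-divisible (+ m ∣? x - y)

modulo-setoid : ℕ → Setoid 0ℓ 0ℓ
modulo-setoid m = record
  { Carrier       = ℤ
  ; _≈_           = λ x y → x ≡ y modulo m
  ; isEquivalence = record { refl = ≡⇒≡-modulo refl ; sym = modulo-sym ; trans = modulo-trans }
  }

-- Integral solutions of relations modulo m

infixl 7 _·_
_·_ : ∀ {k} → (Fin k → ℤ) → (Fin k → ℤ) → ℤ
v · w = sum λ j → v j * w j

·-linearˡ : ∀ {k} α β (x y w : Fin k → ℤ) → (λ j → α * x j + β * y j) · w ≡ α * (x · w) + β * (y · w)
·-linearˡ α β x y w =
  trans (sum-cong-≗ λ j → distrib α β (x j) (y j) (w j)) (sum-linear α β (λ j → x j * w j) (λ j → y j * w j))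
  where
  distrib : ∀ α β x y w → (α * x + β * y) * w ≡ α * (x * w) + β * (y * w)
  distrib = solve-∀

·-scaleʳ : ∀ {k} (v w : Fin k → ℤ) c → v · (λ j → c * w j) ≡ c * (v · w)
·-scaleʳ v w c = trans (sum-cong-≗ λ j → commute (v j) c (w j)) (sym (*-distribˡ-sum c λ j → v j * w j))
  where
  commute : ∀ x c y → x * (c * y) ≡ c * (x * y)
  commute = solve-∀

·-cong-modulo : ∀ {m k} (v : Fin k → ℤ) {x y : Fin k → ℤ} →
                (∀ j → x j ≡ y j modulo m) → v · x ≡ v · y modulo m
·-cong-modulo {k = zero}  v x≡y = ≡⇒≡-modulo refl
·-cong-modulo {k = suc k} v x≡y = modulo-+ (modulo-*ˡ (v zero) (x≡y zero)) (·-cong-modulo (tail v) (x≡y ∘ suc))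

coprime-cancel : ∀ {m d y} → Coprime m ∣ d ∣ → d * y ≡ 0ℤ modulo m → y ≡ 0ℤ modulo m
coprime-cancel {m} {d} {y} d-coprime (divides-difference m∣dy-0) =
  divides-difference (subst (+ m ∣_) (sym (ℤ.+-identityʳ y)) (∣ᵤ⇒∣ (coprime-divisor d-coprime m∣∣d∣∣y∣)))
  where
  m∣∣d∣∣y∣ : m ∣ℕ ∣ d ∣ *ℕ ∣ y ∣
  m∣∣d∣∣y∣ = subst (m ∣ℕ_) (ℤ.abs-* d y) (∣⇒∣ᵤ (subst (+ m ∣_) (ℤ.+-identityʳ (d * y)) m∣dy-0))

ZeroOrCoprime : ℕ → ℤ → Set
ZeroOrCoprime m x = x ≡ 0ℤ ⊎ Coprime m ∣ x ∣

submatrix : ∀ {R : Set} {k s} → (R → Fin k → ℤ) → (Fin s → R) → (Fin s → Fin k) → Matrix s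
submatrix E ρ γ a b = E (ρ a) (γ b)

ZeroOrCoprimeMinors : ∀ {R : Set} {k} → ℕ → (R → Fin k → ℤ) → Set
ZeroOrCoprimeMinors {R} {k} m E =
  ∀ s (ρ : Fin s → R) (γ : Fin s → Fin k) → Injective _≡_ _≡_ γ → ZeroOrCoprime m (det (submatrix E ρ γ))

binary-zeroOrCoprimeMinors : ∀ {R : Set} {k m} .{{_ : NonZero m}} → (∀ q → Prime q → q ∣ℕ m → k ! < 2 *ℕ q) →
                             (E : R → Fin k → ℤ) → (∀ r j → IsBit (E r j)) → ZeroOrCoprimeMinors m E
binary-zeroOrCoprimeMinors {m = m} k!<2q E bin s ρ γ γ-inj with det (submatrix E ρ γ) ℤ.≟ 0ℤ
... | yes D≡0 = inj₁ D≡0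
... | no  D≢0 = inj₂ (no-common-prime⇒coprime λ q prime-q q∣m q∣D →
  ℕ.<⇒≱ (∣D∣<q q prime-q q∣m) (ℕ.∣⇒≤ {{≢-nonZero (D≢0 ∘ ℤ.∣i∣≡0⇒i≡0)}} q∣D))
  where
  ∣D∣<q : ∀ q → Prime q → q ∣ℕ m → ∣ det (submatrix E ρ γ) ∣ < q
  ∣D∣<q q prime-q q∣m = ℕ.≤-<-trans (∣det∣≤halfFactorial (submatrix E ρ γ) (λ a b → bin (ρ a) (γ b)))
    (halfFactorial-< (Fin.injective⇒≤ γ-inj) (k!<2q q prime-q q∣m) (nonTrivial⇒n>1 q {{prime⇒nonTrivial prime-q}}))

zeroOrCoprimeMinors-tail : ∀ {R : Set} {k m} {E : R → Fin (suc k) → ℤ} →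
                           ZeroOrCoprimeMinors m E → ZeroOrCoprimeMinors m (tail ∘ E)
zeroOrCoprimeMinors-tail minors s ρ γ γ-inj = minors s ρ (suc ∘ γ) (γ-inj ∘ Fin.suc-injective)

from-Fin1-injective : ∀ {A : Set} {f : Fin 1 → A} → Injective _≡_ _≡_ f
from-Fin1-injective {x = zero} {zero} _ = refl

pivot-coprime : ∀ {R : Set} {k m} {E : R → Fin (suc k) → ℤ} {p} →
                ZeroOrCoprimeMinors m E → E p zero ≢ 0ℤ → Coprime m ∣ E p zero ∣
pivot-coprime {E = E} {p} minors a≢0 with minors 1 (λ _ → p) (λ _ → zero) from-Fin1-injective
... | inj₁ D≡0 = contradiction (trans (sym (det₁ (λ _ _ → E p zero))) D≡0) a≢0
... | inj₂ cop = subst (Coprime _ ∘ ∣_∣) (det₁ (λ _ _ → E p zero)) cop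

condenseRows : ∀ {R : Set} {k} → (R → Fin (suc k) → ℤ) → R → R → Fin k → ℤ
condenseRows E p r j = E p zero * E r (suc j) - E r zero * E p (suc j)

zero∷suc-injective : ∀ {s k} {γ : Fin s → Fin k} → Injective _≡_ _≡_ γ → Injective _≡_ _≡_ (zero ∷ suc ∘ γ)
zero∷suc-injective γ-inj {zero}  {zero}  _ = refl
zero∷suc-injective γ-inj {suc x} {suc y} e = cong suc (γ-inj (Fin.suc-injective e))

zeroOrCoprimeMinors-condense : ∀ {R : Set} {k m} {E : R → Fin (suc k) → ℤ} {p} →
                               ZeroOrCoprimeMinors m E → E p zero ≢ 0ℤ → ZeroOrCoprimeMinors m (condenseRows E p)
zeroOrCoprimeMinors-condense {m = m} {E} {p} minors a≢0 s ρ γ γ-inj =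
  transfer (minors (suc s) (p ∷ ρ) (zero ∷ suc ∘ γ) (zero∷suc-injective γ-inj))
  where
  a = E p zero
  X = det (submatrix (condenseRows E p) ρ γ)
  N = det (submatrix E (p ∷ ρ) (zero ∷ suc ∘ γ))
  -- The condensation of the bordered minor N is, by definition, the minor X of the condensed rows.
  chio : a * X ≡ a ^ s * N
  chio = det-condense (submatrix E (p ∷ ρ) (zero ∷ suc ∘ γ))
  transfer : ZeroOrCoprime m N → ZeroOrCoprime m X
  transfer (inj₁ N≡0) with ℤ.i*j≡0⇒i≡0∨j≡0 a (trans chio (trans (cong (a ^ s *_) N≡0) (ℤ.*-zeroʳ (a ^ s))))
  ... | inj₁ a≡0 = contradiction a≡0 a≢0
  ... | inj₂ X≡0 = inj₁ X≡0
  transfer (inj₂ N-coprime) = inj₂ (coprime-∣⇒coprime aˢN-coprime X∣aˢN)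
    where
    aˢN-coprime : Coprime m ∣ a ^ s * N ∣
    aˢN-coprime = coprime-∣*∣ (a ^ s) N (coprime-∣^∣ a s (pivot-coprime {E = E} minors a≢0)) N-coprime
    X∣aˢN : ∣ X ∣ ∣ℕ ∣ a ^ s * N ∣
    X∣aˢN = subst (∣ X ∣ ∣ℕ_) (trans (sym (ℤ.abs-* a X)) (cong ∣_∣ chio)) (ℕ.∣n⇒∣m*n ∣ a ∣ ℕ.∣-refl)

condenseRows-· : ∀ {R : Set} {k} (E : R → Fin (suc k) → ℤ) p r (w : Fin k → ℤ) →
                 condenseRows E p r · w ≡ E p zero * (tail (E r) · w) - E r zero * (tail (E p) · w)
condenseRows-· E p r w = begin
  condenseRows E p r · w
    ≡⟨ sum-cong-≗ (λ j → cong (λ y → (E p zero * E r (suc j) + y) * w j)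
                             (ℤ.neg-distribˡ-* (E r zero) (E p (suc j)))) ⟩
  (λ j → E p zero * E r (suc j) + - E r zero * E p (suc j)) · w
    ≡⟨ ·-linearˡ (E p zero) (- E r zero) (tail (E r)) (tail (E p)) w ⟩
  E p zero * (tail (E r) · w) + - E r zero * (tail (E p) · w)
    ≡⟨ cong (_+_ (E p zero * (tail (E r) · w))) (ℤ.neg-distribˡ-* (E r zero) (tail (E p) · w)) ⟨
  E p zero * (tail (E r) · w) - E r zero * (tail (E p) · w) ∎
  where open ≡-Reasoning

condenseRows-relation : ∀ {R : Set} {k m} (E : R → Fin (suc k) → ℤ) (u : Fin (suc k) → ℤ) p →
                        (∀ r → E r · u ≡ 0ℤ modulo m) → ∀ r → condenseRows E p r · tail u ≡ 0ℤ modulo m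
condenseRows-relation {m = m} E u p rel r = begin
  condenseRows E p r · tail u
    ≡⟨ condenseRows-· E p r (tail u) ⟩
  E p zero * (tail (E r) · tail u) - E r zero * (tail (E p) · tail u)
    ≡⟨ expand (E p zero) (E r zero) (u zero) _ _ ⟩
  E p zero * (E r · u) - E r zero * (E p · u)
    ≈⟨ modulo-+ (modulo-*ˡ (E p zero) (rel r)) (modulo-neg (modulo-*ˡ (E r zero) (rel p))) ⟩
  E p zero * 0ℤ - E r zero * 0ℤ
    ≡⟨ vanish (E p zero) (E r zero) ⟩
  0ℤ ∎
  where
  open SetoidReasoning (modulo-setoid m)
  expand : ∀ a c u₀ tr tp → a * tr - c * tp ≡ a * (c * u₀ + tr) - c * (a * u₀ + tp)
  expand = solve-∀
  vanish : ∀ a c → a * 0ℤ - c * 0ℤ ≡ 0ℤ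
  vanish = solve-∀

record IntegralLift (m : ℕ) {R : Set} {k} (E : R → Fin k → ℤ) (u : Fin k → ℤ) : Set where
  field
    z         : Fin k → ℤ
    d         : ℤ
    d-coprime : Coprime m ∣ d ∣
    E·z≡0     : ∀ r → E r · z ≡ 0ℤ
    z≡d*u     : ∀ j → z j ≡ d * u j modulo m

integralLift-zeroColumn : ∀ {R : Set} {k m} {E : R → Fin (suc k) → ℤ} {u} →
                          (∀ r → E r zero ≡ 0ℤ) → IntegralLift m (tail ∘ E) (tail u) → IntegralLift m E u
integralLift-zeroColumn {E = E} {u} E₀≡0 L = record
  { z         = d * u zero ∷ z
  ; d         = d
  ; d-coprime = d-coprime
  ; E·z≡0     = λ r → trans (cong (λ x → x * (d * u zero) + tail (E r) · z) (E₀≡0 r))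
                            (trans (ℤ.+-identityˡ (tail (E r) · z)) (E·z≡0 r))
  ; z≡d*u     = λ { zero → ≡⇒≡-modulo refl ; (suc j) → z≡d*u j }
  }
  where open IntegralLift L

integralLift-pivot : ∀ {R : Set} {k m} {E : R → Fin (suc k) → ℤ} {u} p → Coprime m ∣ E p zero ∣ →
                     E p · u ≡ 0ℤ modulo m → IntegralLift m (condenseRows E p) (tail u) → IntegralLift m E u
integralLift-pivot {m = m} {E} {u} p a-coprime Ep·u≡0 L = record
  { z         = - (tail (E p) · z) ∷ λ j → a * z j
  ; d         = a * d
  ; d-coprime = coprime-∣*∣ a d a-coprime d-coprime
  ; E·z≡0     = E·z′≡0
  ; z≡d*u     = z′≡d′*u
  }
  where
  open IntegralLift L
  a = E p zero
  E·z′≡0 : ∀ r → E r · (- (tail (E p) · z) ∷ λ j → a * z j) ≡ 0ℤ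
  E·z′≡0 r = begin
    E r zero * - (tail (E p) · z) + tail (E r) · (λ j → a * z j)
      ≡⟨ cong (_+_ (E r zero * - (tail (E p) · z))) (·-scaleʳ (tail (E r)) z a) ⟩
    E r zero * - (tail (E p) · z) + a * (tail (E r) · z)
      ≡⟨ reorder (E r zero) (tail (E p) · z) a (tail (E r) · z) ⟩
    a * (tail (E r) · z) - E r zero * (tail (E p) · z)
      ≡⟨ condenseRows-· E p r z ⟨
    condenseRows E p r · z
      ≡⟨ E·z≡0 r ⟩
    0ℤ ∎
    where
    open ≡-Reasoning
    reorder : ∀ c t a s → c * - t + a * s ≡ a * s - c * t
    reorder = solve-∀
  z′≡d′*u : ∀ j → (- (tail (E p) · z) ∷ λ j → a * z j) j ≡ (a * d) * u j modulo m
  z′≡d′*u zero = begin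
    - (tail (E p) · z)                              ≈⟨ modulo-neg (·-cong-modulo (tail (E p)) (z≡d*u)) ⟩
    - (tail (E p) · (λ j → d * u (suc j)))          ≡⟨ cong -_ (·-scaleʳ (tail (E p)) (tail u) d) ⟩
    - (d * (tail (E p) · tail u))                   ≡⟨ expand a d (u zero) (tail (E p) · tail u) ⟩
    a * d * u zero - d * (E p · u)                  ≈⟨ modulo-+ (≡⇒≡-modulo {x = a * d * u zero} refl)
                                                                (modulo-neg (modulo-*ˡ d Ep·u≡0)) ⟩
    a * d * u zero - d * 0ℤ                         ≡⟨ cancel (a * d * u zero) d ⟩
    a * d * u zero ∎
    where
    open SetoidReasoning (modulo-setoid m)
    expand : ∀ a d u₀ t → - (d * t) ≡ a * d * u₀ - d * (a * u₀ + t)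
    expand = solve-∀
    cancel : ∀ x d → x - d * 0ℤ ≡ x
    cancel = solve-∀
  z′≡d′*u (suc j) = subst (λ y → a * z j ≡ y modulo m) (sym (ℤ.*-assoc a d (u (suc j)))) (modulo-*ˡ a (z≡d*u j))

Searchable : Set → Set₁
Searchable R = ∀ {P : Pred R 0ℓ} → Decidable P → Dec (∃ P)

integralLift : ∀ {R : Set} {k m} → Searchable R → (E : R → Fin k → ℤ) (u : Fin k → ℤ) →
               ZeroOrCoprimeMinors m E → (∀ r → E r · u ≡ 0ℤ modulo m) → IntegralLift m E u
integralLift {k = zero} search E u minors rel = record
  { z = λ () ; d = 1ℤ ; d-coprime = coprime-1 ; E·z≡0 = λ _ → refl ; z≡d*u = λ () }
integralLift {k = suc k} search E u minors rel with search (λ r → ¬? (E r zero ℤ.≟ 0ℤ))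
... | yes (p , a≢0) = integralLift-pivot p (pivot-coprime {E = E} minors a≢0) (rel p)
  (integralLift search (condenseRows E p) (tail u) (zeroOrCoprimeMinors-condense {E = E} minors a≢0)
                (condenseRows-relation E u p rel))
... | no noPivot = integralLift-zeroColumn E₀≡0
  (integralLift search (tail ∘ E) (tail u) (zeroOrCoprimeMinors-tail {E = E} minors) tail-rel)
  where
  E₀≡0 : ∀ r → E r zero ≡ 0ℤ
  E₀≡0 r = decidable-stable (E r zero ℤ.≟ 0ℤ) (λ ne → noPivot (r , ne))
  tail-rel : ∀ r → tail (E r) · tail u ≡ 0ℤ modulo _
  tail-rel r = subst (λ x → x ≡ 0ℤ modulo _)
                     (trans (cong (λ x → x * u zero + tail (E r) · tail u) (E₀≡0 r)) (ℤ.+-identityˡ _)) (rel r)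

-- Residues and partial sums

module Residues (m : ℕ) .{{_ : NonZero m}} where

  rep : Fin m → ℤ
  rep a = + toℕ a

  reduce : ℤ → Fin m
  reduce x = fromℕ< (n%ℕd<d x m)

  %ℕ-modulo : ∀ x → + (x %ℕ m) ≡ x modulo m
  %ℕ-modulo x = divides-difference (divides (- (x /ℕ m)) (begin
    + (x %ℕ m) - x                             ≡⟨ cong (_-_ (+ (x %ℕ m))) (a≡a%ℕn+[a/ℕn]*n x m) ⟩
    + (x %ℕ m) - (+ (x %ℕ m) + x /ℕ m * + m)   ≡⟨ cancel (+ (x %ℕ m)) (x /ℕ m) (+ m) ⟩
    - (x /ℕ m) * + m                           ∎))
    where
    open ≡-Reasoning
    cancel : ∀ r q m → r - (r + q * m) ≡ - q * m
    cancel = solve-∀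

  rep-reduce : ∀ x → rep (reduce x) ≡ x modulo m
  rep-reduce x = subst (λ r → + r ≡ x modulo m) (sym (Fin.toℕ-fromℕ< (n%ℕd<d x m))) (%ℕ-modulo x)

  rep-mod : ∀ n → rep (n mod m) ≡ + n modulo m
  rep-mod n = subst (λ r → + r ≡ + n modulo m) (sym (Fin.toℕ-fromℕ< (m%n<n n m))) (%ℕ-modulo (+ n))

  rep-0ₘ : rep (0ₘ m) ≡ 0ℤ modulo m
  rep-0ₘ = rep-mod 0

  rep-+ₘ : ∀ a b → rep (_+ₘ_ m a b) ≡ rep a + rep b modulo m
  rep-+ₘ a b = subst (rep (_+ₘ_ m a b) ≡_modulo m) (ℤ.pos-+ (toℕ a) (toℕ b)) (rep-mod (toℕ a +ℕ toℕ b))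

  reduce-injective : ∀ {x y} → reduce x ≡ reduce y → x ≡ y modulo m
  reduce-injective {x} {y} rx≡ry =
    modulo-trans (modulo-sym (rep-reduce x)) (modulo-trans (≡⇒≡-modulo (cong rep rx≡ry)) (rep-reduce y))

  reduce≡0ₘ : ∀ {x} → reduce x ≡ 0ₘ m → x ≡ 0ℤ modulo m
  reduce≡0ₘ {x} rx≡0 =
    modulo-trans (modulo-sym (rep-reduce x)) (modulo-trans (≡⇒≡-modulo (cong rep rx≡0)) rep-0ₘ)

  small-≡0 : ∀ {x} → x ≡ 0ℤ modulo m → ∣ x ∣ < m → x ≡ 0ℤ
  small-≡0 {x} (divides-difference m∣x-0) ∣x∣<m with ∣ x ∣ ℕ.≟ 0
  ... | yes ∣x∣≡0 = ℤ.∣i∣≡0⇒i≡0 ∣x∣≡0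
  ... | no  ∣x∣≢0 = contradiction (ℕ.∣⇒≤ {{≢-nonZero ∣x∣≢0}} m∣∣x∣) (ℕ.<⇒≱ ∣x∣<m)
    where
    m∣∣x∣ : m ∣ℕ ∣ x ∣
    m∣∣x∣ = ∣⇒∣ᵤ (subst (+ m ∣_) (ℤ.+-identityʳ x) m∣x-0)

  rep-injective : ∀ {a b} → rep a ≡ rep b modulo m → a ≡ b
  rep-injective {a} {b} a≡b =
    Fin.toℕ-injective (ℤ.+-injective (ℤ.i-j≡0⇒i≡j _ _ (small-≡0 (modulo-difference a≡b) ∣a-b∣<m)))
    where
    ∣a-b∣<m : ∣ rep a - rep b ∣ < m
    ∣a-b∣<m = subst (_< m) (sym (cong ∣_∣ (ℤ.m-n≡m⊖n (toℕ a) (toℕ b))))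
                    (ℕ.≤-<-trans (ℤ.∣m⊝n∣≤m⊔n (toℕ a) (toℕ b)) (ℕ.⊔-lub (Fin.toℕ<n a) (Fin.toℕ<n b)))

prefixSum : ∀ {k} → (Fin k → ℤ) → Fin (suc k) → ℤ
prefixSum         g zero    = 0ℤ
prefixSum {suc k} g (suc i) = g zero + prefixSum (tail g) i

prefixSum-modulo : ∀ {m k} {x y : Fin k → ℤ} → (∀ j → x j ≡ y j modulo m) →
                   ∀ i → prefixSum x i ≡ prefixSum y i modulo m
prefixSum-modulo             x≡y zero    = ≡⇒≡-modulo refl
prefixSum-modulo {k = suc k} x≡y (suc i) = modulo-+ (x≡y zero) (prefixSum-modulo (x≡y ∘ suc) i)

prefixSum-scale : ∀ {k} c (x : Fin k → ℤ) i → prefixSum (λ j → c * x j) i ≡ c * prefixSum x i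
prefixSum-scale         c x zero    = sym (ℤ.*-zeroʳ c)
prefixSum-scale {suc k} c x (suc i) =
  trans (cong (_+_ (c * x zero)) (prefixSum-scale c (tail x) i))
        (sym (ℤ.*-distribˡ-+ c (x zero) (prefixSum (tail x) i)))

‖_‖₁ : ∀ {k} → (Fin k → ℤ) → ℕ
‖_‖₁ {zero}  x = 0
‖_‖₁ {suc k} x = ∣ x zero ∣ +ℕ ‖ tail x ‖₁

∣entry∣≤‖‖₁ : ∀ {k} (x : Fin k → ℤ) j → ∣ x j ∣ ≤ ‖ x ‖₁
∣entry∣≤‖‖₁ x zero    = ℕ.m≤m+n _ _
∣entry∣≤‖‖₁ x (suc j) = ℕ.≤-trans (∣entry∣≤‖‖₁ (tail x) j) (ℕ.m≤n+m _ _)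

∣prefixSum∣≤‖‖₁ : ∀ {k} (x : Fin k → ℤ) i → ∣ prefixSum x i ∣ ≤ ‖ x ‖₁
∣prefixSum∣≤‖‖₁         x zero    = z≤n
∣prefixSum∣≤‖‖₁ {suc k} x (suc i) =
  ℕ.≤-trans (ℤ.∣i+j∣≤∣i∣+∣j∣ (x zero) _) (ℕ.+-monoʳ-≤ ∣ x zero ∣ (∣prefixSum∣≤‖‖₁ (tail x) i))

indicator : ∀ {k} → (Fin k → Bool) → Fin k → ℤ
indicator v j = if v j then 1ℤ else 0ℤ

indicator-bit : ∀ {k} (v : Fin k → Bool) j → IsBit (indicator v j)
indicator-bit v j with v j
... | true  = inj₂ refl
... | false = inj₁ refl

-- interval i j r holds iff i ≤ r < j.
interval : ∀ {k} → Fin (suc k) → Fin (suc k) → Fin k → Bool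
interval zero    zero    r       = false
interval zero    (suc j) zero    = true
interval zero    (suc j) (suc r) = interval zero j r
interval (suc i) j       zero    = false
interval (suc i) zero    (suc r) = false
interval (suc i) (suc j) (suc r) = interval i j r

prefixSum-interval : ∀ {k} (g : Fin k → ℤ) {i j : Fin (suc k)} → i ≤ᶠ j →
                     prefixSum g j ≡ prefixSum g i + indicator (interval i j) · g
prefixSum-interval {zero}  g {zero} {zero} _ = refl
prefixSum-interval {suc k} g {zero} {zero} _ =
  sym (trans (ℤ.+-identityˡ _) (sum-zero {f = λ r → indicator (interval zero zero) r * g r} (λ _ → refl)))
prefixSum-interval {suc k} g {zero} {suc j} _ =
  trans (cong (_+_ (g zero)) (prefixSum-interval (tail g) {zero} {j} z≤n))
        (shift (g zero) (indicator (interval zero j) · tail g))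
  where
  shift : ∀ a s → a + (0ℤ + s) ≡ 0ℤ + (1ℤ * a + s)
  shift = solve-∀
prefixSum-interval {suc k} g {suc i} {suc j} (s≤s i≤j) =
  trans (cong (_+_ (g zero)) (prefixSum-interval (tail g) i≤j))
        (shift (g zero) (prefixSum (tail g) i) (indicator (interval i j) · tail g))
  where
  shift : ∀ a p s → a + (p + s) ≡ a + p + (0ℤ + s)
  shift = solve-∀

indicator-permute : ∀ {k} (π : Permutation′ k) (v : Fin k → Bool) (g : Fin k → ℤ) →
                    indicator (v ∘ (π ⟨$⟩ˡ_)) · g ≡ indicator v · (g ∘ (π ⟨$⟩ʳ_))
indicator-permute π v g = trans (∑-permute (λ t → indicator (v ∘ (π ⟨$⟩ˡ_)) t * g t) π)
  (sum-cong-≗ λ r → cong (λ t → indicator v t * g (π ⟨$⟩ʳ r)) (inverseˡ π))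

module PartialSums {c ℓ} (H : AbelianGroup c ℓ) (m : ℕ) .{{_ : NonZero m}} where
  open Setup H m
  open Residues m

  residue : Elem → ℤ
  residue = rep ∘ proj₁

  residue-partial : ∀ {k} (x : Fin k → Elem) i → residue (partial x i) ≡ prefixSum (residue ∘ x) i modulo m
  residue-partial         x zero    = rep-0ₘ
  residue-partial {suc k} x (suc i) =
    modulo-trans (rep-+ₘ (proj₁ (x zero)) (proj₁ (partial (tail x) i)))
                 (modulo-+ (≡⇒≡-modulo {x = residue (x zero)} refl) (residue-partial (tail x) i))

partial-proj₂ : ∀ {c ℓ} (H : AbelianGroup c ℓ) m n .{{_ : NonZero m}} .{{_ : NonZero n}} {k}
                (x : Fin k → Setup.Elem H m) (y : Fin k → Setup.Elem H n) → (∀ j → proj₂ (x j) ≡ proj₂ (y j)) →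
                ∀ i → proj₂ (Setup.partial H m x i) ≡ proj₂ (Setup.partial H n y i)
partial-proj₂ H m n x y x≡y zero    = refl
partial-proj₂ H m n {suc k} x y x≡y (suc i) =
  cong₂ (AbelianGroup._∙_ H) (x≡y zero) (partial-proj₂ H m n (tail x) (tail y) (x≡y ∘ suc) i)

block : ∀ {k} → Permutation′ k → Fin (suc k) → Fin (suc k) → Subset k
block σ i j = tabulate (interval i j ∘ (σ ⟨$⟩ˡ_))

block-· : ∀ {k} (σ : Permutation′ k) (g : Fin k → ℤ) {i j} → i ≤ᶠ j →
          indicator (lookup (block σ i j)) · g ≡ prefixSum (g ∘ (σ ⟨$⟩ʳ_)) j - prefixSum (g ∘ (σ ⟨$⟩ʳ_)) i
block-· σ g {i} {j} i≤j = begin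
  indicator (lookup (block σ i j)) · g
    ≡⟨ sum-cong-≗ (λ t → cong (λ b → (if b then 1ℤ else 0ℤ) * g t)
                             (lookup∘tabulate (interval i j ∘ (σ ⟨$⟩ˡ_)) t)) ⟩
  indicator (interval i j ∘ (σ ⟨$⟩ˡ_)) · g
    ≡⟨ indicator-permute σ (interval i j) g ⟩
  indicator (interval i j) · gσ
    ≡⟨ cancel (prefixSum gσ i) _ ⟨
  prefixSum gσ i + indicator (interval i j) · gσ - prefixSum gσ i
    ≡⟨ cong (_- prefixSum gσ i) (prefixSum-interval gσ i≤j) ⟨
  prefixSum gσ j - prefixSum gσ i ∎
  where
  open ≡-Reasoning
  gσ = g ∘ (σ ⟨$⟩ʳ_)
  cancel : ∀ a s → a + s - a ≡ s
  cancel = solve-∀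

-- Reduction to a prime

module Reduction {c ℓ} (H : AbelianGroup c ℓ) (m : ℕ) .{{_ : NonZero m}} {K} (S : Fin K → Setup.Elem H m) where
  open Setup H m
  open Residues m
  open PartialSums H m
  open AbelianGroup H using () renaming (_≈_ to _≈H_)

  u : Fin K → ℤ
  u = residue ∘ S

  -- Subsets that are not relations give zero rows, so that the rows are indexed by a searchable type.
  relationRow : Subset K → Fin K → ℤ
  relationRow v with indicator (lookup v) · u ≡? 0ℤ modulo m
  ... | yes _ = indicator (lookup v)
  ... | no  _ = λ _ → 0ℤ

  relationRow-bit : ∀ v j → IsBit (relationRow v j)
  relationRow-bit v j with indicator (lookup v) · u ≡? 0ℤ modulo m
  ... | yes _ = indicator-bit (lookup v) j
  ... | no  _ = inj₁ refl

  relationRow-relation : ∀ v → relationRow v · u ≡ 0ℤ modulo m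
  relationRow-relation v with indicator (lookup v) · u ≡? 0ℤ modulo m
  ... | yes v·u≡0 = v·u≡0
  ... | no  _     = ≡⇒≡-modulo (sum-zero {f = λ j → 0ℤ * u j} (λ _ → refl))

  relationRow-relation⁻¹ : ∀ v → indicator (lookup v) · u ≡ 0ℤ modulo m → relationRow v ≡ indicator (lookup v)
  relationRow-relation⁻¹ v v·u≡0 with indicator (lookup v) · u ≡? 0ℤ modulo m
  ... | yes _       = refl
  ... | no  v·u≢0   = contradiction v·u≡0 v·u≢0

  relationLift : (∀ q → Prime q → q ∣ℕ m → K ! < 2 *ℕ q) → IntegralLift m relationRow u
  relationLift K!<2q = integralLift anySubset? relationRow u
    (binary-zeroOrCoprimeMinors K!<2q relationRow relationRow-bit) relationRow-relation

  module AtPrime (L : IntegralLift m relationRow u) (p : ℕ) .{{_ : NonZero p}}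
                 (p-large : ‖ IntegralLift.z L ‖₁ +ℕ ‖ IntegralLift.z L ‖₁ < p) where
    open IntegralLift L
    module P = Setup H p
    module Rₚ = Residues p
    module Pₚ = PartialSums H p

    S′ : Fin K → P.Elem
    S′ j = Rₚ.reduce (z j) , proj₂ (S j)

    ≡0-modulo-p⇒≡0-modulo-m : ∀ {x y} → x ≡ d * y modulo m → x ≡ 0ℤ modulo p → ∣ x ∣ < p → y ≡ 0ℤ modulo m
    ≡0-modulo-p⇒≡0-modulo-m x≡dy x≡0 ∣x∣<p =
      coprime-cancel {d = d} d-coprime (modulo-trans (modulo-sym x≡dy) (≡⇒≡-modulo (Rₚ.small-≡0 x≡0 ∣x∣<p)))

    ∣z∣<p : ∀ j → ∣ z j ∣ < p
    ∣z∣<p j = ℕ.≤-<-trans (ℕ.≤-trans (∣entry∣≤‖‖₁ z j) (ℕ.m≤m+n _ _)) p-large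

    ∣z-z∣<p : ∀ i j → ∣ z i - z j ∣ < p
    ∣z-z∣<p i j = ℕ.≤-<-trans (ℕ.≤-trans (ℤ.∣i-j∣≤∣i∣+∣j∣ (z i) (z j))
                                          (ℕ.+-mono-≤ (∣entry∣≤‖‖₁ z i) (∣entry∣≤‖‖₁ z j))) p-large

    ∣prefixSum∣<p : ∀ i → ∣ prefixSum z i ∣ < p
    ∣prefixSum∣<p i = ℕ.≤-<-trans (ℕ.≤-trans (∣prefixSum∣≤‖‖₁ z i) (ℕ.m≤m+n _ _)) p-large

    S′-subset : IsSubsetNoZero S → P.IsSubsetNoZero S′
    S′-subset (S-injective , S-nonZero) = S′-injective , S′-nonZero
      where
      S′-injective : ∀ i j → S′ i P.≈ S′ j → i ≡ j
      S′-injective i j (reduce-zi≡zj , hi≈hj) = S-injective i j (rep-injective ui≡uj , hi≈hj)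
        where
        zi-zj≡d[ui-uj] : z i - z j ≡ d * (u i - u j) modulo m
        zi-zj≡d[ui-uj] =
          modulo-trans (modulo-+ (z≡d*u i) (modulo-neg (z≡d*u j))) (≡⇒≡-modulo (factor d (u i) (u j)))
          where
          factor : ∀ d x y → d * x - d * y ≡ d * (x - y)
          factor = solve-∀
        ui≡uj : u i ≡ u j modulo m
        ui≡uj = difference-modulo (≡0-modulo-p⇒≡0-modulo-m zi-zj≡d[ui-uj] zi-zj≡0 (∣z-z∣<p i j))
          where
          zi-zj≡0 : z i - z j ≡ 0ℤ modulo p
          zi-zj≡0 = modulo-difference (Rₚ.reduce-injective {z i} {z j} reduce-zi≡zj)
      S′-nonZero : ∀ i → ¬ (S′ i P.≈ P.𝟘)
      S′-nonZero i (reduce-zi≡0 , hi≈ε) = S-nonZero i (rep-injective ui≡0 , hi≈ε)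
        where
        ui≡0 : u i ≡ rep (0ₘ m) modulo m
        ui≡0 = modulo-trans (≡0-modulo-p⇒≡0-modulo-m (z≡d*u i) (Rₚ.reduce≡0ₘ {z i} reduce-zi≡0) (∣z∣<p i)) (modulo-sym rep-0ₘ)

    S′-nonZeroSum : NonZeroSum S → P.NonZeroSum S′
    S′-nonZeroSum S-nonZeroSum (reduce-Σ≡0 , h≈ε) =
      S-nonZeroSum (rep-injective ΣS≡0 , subst (_≈H _) (partial-proj₂ H p m S′ S (λ _ → refl) (fromℕ K)) h≈ε)
      where
      Σz≡0 : prefixSum z (fromℕ K) ≡ 0ℤ modulo p
      Σz≡0 = begin
        prefixSum z (fromℕ K)
          ≈⟨ prefixSum-modulo (λ j → modulo-sym (Rₚ.rep-reduce (z j))) (fromℕ K) ⟩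
        prefixSum (Pₚ.residue ∘ S′) (fromℕ K)
          ≈⟨ modulo-sym (Pₚ.residue-partial S′ (fromℕ K)) ⟩
        Pₚ.residue (P.sumAll S′)
          ≡⟨ cong Rₚ.rep reduce-Σ≡0 ⟩
        Rₚ.rep (0ₘ p)
          ≈⟨ Rₚ.rep-0ₘ ⟩
        0ℤ ∎
        where open SetoidReasoning (modulo-setoid p)
      Σz≡dΣu : prefixSum z (fromℕ K) ≡ d * prefixSum u (fromℕ K) modulo m
      Σz≡dΣu = modulo-trans (prefixSum-modulo z≡d*u (fromℕ K)) (≡⇒≡-modulo (prefixSum-scale d u (fromℕ K)))
      ΣS≡0 : residue (sumAll S) ≡ rep (0ₘ m) modulo m
      ΣS≡0 = begin
        residue (sumAll S)     ≈⟨ residue-partial S (fromℕ K) ⟩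
        prefixSum u (fromℕ K)  ≈⟨ ≡0-modulo-p⇒≡0-modulo-m Σz≡dΣu Σz≡0 (∣prefixSum∣<p (fromℕ K)) ⟩
        0ℤ                     ≈⟨ modulo-sym rep-0ₘ ⟩
        rep (0ₘ m)             ∎
        where open SetoidReasoning (modulo-setoid m)

    relation-annihilated : ∀ v → indicator (lookup v) · u ≡ 0ℤ modulo m → indicator (lookup v) · z ≡ 0ℤ
    relation-annihilated v v·u≡0 = trans (cong (_· z) (sym (relationRow-relation⁻¹ v v·u≡0))) (E·z≡0 v)

    collision-transfers : ∀ (σ : Permutation′ K) {i j} → i <ᶠ j →
                          partial (S ∘ (σ ⟨$⟩ʳ_)) i ≈ partial (S ∘ (σ ⟨$⟩ʳ_)) j →
                          P.partial (S′ ∘ (σ ⟨$⟩ʳ_)) i P.≈ P.partial (S′ ∘ (σ ⟨$⟩ʳ_)) j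
    collision-transfers σ {i} {j} i<j (residues-equal , h-equal) =
      Rₚ.rep-injective residues-equal′ ,
      subst₂ _≈H_ (partial-proj₂ H m p x y (λ _ → refl) i) (partial-proj₂ H m p x y (λ _ → refl) j) h-equal
      where
      x = S ∘ (σ ⟨$⟩ʳ_)
      y = S′ ∘ (σ ⟨$⟩ʳ_)
      uσ = u ∘ (σ ⟨$⟩ʳ_)
      zσ = z ∘ (σ ⟨$⟩ʳ_)
      block·u≡0 : indicator (lookup (block σ i j)) · u ≡ 0ℤ modulo m
      block·u≡0 = begin
        indicator (lookup (block σ i j)) · u           ≡⟨ block-· σ u (ℕ.<⇒≤ i<j) ⟩
        prefixSum uσ j - prefixSum uσ i                ≈⟨ modulo-+ (modulo-sym (residue-partial x j))
                                                                    (modulo-neg (modulo-sym (residue-partial x i))) ⟩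
        residue (partial x j) - residue (partial x i)  ≡⟨ cong (λ a → residue (partial x j) - rep a) residues-equal ⟩
        residue (partial x j) - residue (partial x j)  ≡⟨ ℤ.+-inverseʳ (residue (partial x j)) ⟩
        0ℤ                                             ∎
        where open SetoidReasoning (modulo-setoid m)
      zσ-prefixes : prefixSum zσ i ≡ prefixSum zσ j
      zσ-prefixes = sym (ℤ.i-j≡0⇒i≡j _ _ (trans (sym (block-· σ z (ℕ.<⇒≤ i<j)))
                                                  (relation-annihilated (block σ i j) block·u≡0)))
      residues-equal′ : Pₚ.residue (P.partial y i) ≡ Pₚ.residue (P.partial y j) modulo p
      residues-equal′ = begin
        Pₚ.residue (P.partial y i)    ≈⟨ Pₚ.residue-partial y i ⟩
        prefixSum (Pₚ.residue ∘ y) i  ≈⟨ prefixSum-modulo (λ r → Rₚ.rep-reduce (zσ r)) i ⟩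
        prefixSum zσ i                ≡⟨ zσ-prefixes ⟩
        prefixSum zσ j                ≈⟨ prefixSum-modulo (λ r → modulo-sym (Rₚ.rep-reduce (zσ r))) j ⟩
        prefixSum (Pₚ.residue ∘ y) j  ≈⟨ modulo-sym (Pₚ.residue-partial y j) ⟩
        Pₚ.residue (P.partial y j)    ∎
        where open SetoidReasoning (modulo-setoid p)

    sequenceable-back : P.Sequenceable S′ → Sequenceable S
    sequenceable-back (σ , distinct) =
      σ , λ i j i<j collision → distinct i j i<j (collision-transfers σ i<j collision)

theorem4p12 : ∀ {c ℓ : Level} (H : AbelianGroup c ℓ) (t : ℕ) (E : Enumeration H t)
    (lam : Fin t → ℕ) →
    InfinitelyManyPrimes H E lam →
    (m : ℕ) .{{_ : NonZero m}} →
    (∀ (q : ℕ) → Prime q → q ∣ℕ m → (total lam) ! < 2 *ℕ q) →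
    AllSequenceable H E lam m
theorem4p12 H t E lam primes m K!<2q S S-subset S-nonZeroSum S-type =
  let open Reduction H m S
      L = relationLift K!<2q
      (p , prime-p , p-large , sequenceable-at-p) = primes (‖ IntegralLift.z L ‖₁ +ℕ ‖ IntegralLift.z L ‖₁)
      open AtPrime L p {{prime⇒nonZero prime-p}} p-large
  in sequenceable-back (sequenceable-at-p S′ (S′-subset S-subset) (S′-nonZeroSum S-nonZeroSum) S-type)
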